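{- Let $X\in\{A,B\}$, $Y\in\{A,B,-\}$, and let $\mathcal F$ be a family of graphs such that a graph is $[X,Y]$-perfect if and only if it contains no member of $\mathcal F$ as an induced subgraph. Then for every graph $G$ the following are equivalent: (1) $G$ is line $[X,Y]$-perfect; (2) no graph in $L^{ -1}(\mathcal F)$ is an edge-induced subgraph of $G$; (3) no graph in $L^{ -1}(\mathrm{red}(\mathcal F))$ is an edge-induced subgraph of $G$.
   Context: All graphs are finite and simple. Vertex game: in the $[X,Y]$-colouring game with $k$ colours on a graph $H$, Alice (A) and Bob (B) alternately colour an uncoloured vertex with one of $k$ colours so that adjacent vertices get distinct colours; player $X$ moves first; if $Y\in\{A,B\}$ only player $Y$ may skip moves, if $Y=-$ nobody may skip; the game ends when no move is possible, and Alice wins iff all vertices are coloured. $\chi_{[X,Y]}(H)$ is the least $k$ for which Alice has a winning strategy; $H$ is $[X,Y]$-perfect if $\chi_{[X,Y]}(H')=\omega(H')$ for every induced subgraph $H'$ of $H$ ($\omega$ = clique number). The $[X,Y]$-edge colouring game is defined identically but colouring edges, adjacent meaning sharing an endpoint; $\chi'_{[X,Y]}(G)$ is its least winning number of colours. An edge-induced subgraph of $G$ is a subgraph formed by a subset of edges together with their endpoints. $G$ is line $[X,Y]$-perfect if $\chi'_{[X,Y]}(H)=\omega(L(H))$ for every edge-induced subgraph $H$ of $G$, where $L(H)$ is the line graph. A graph is iso-free if it has no isolated vertices. For a family $\mathcal F$, $L^{ -1}(\mathcal F)$ is the set of all iso-free graphs $H$ with $L(H)\in\mathcal F$ (up to isomorphism),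 and $\mathrm{red}(\mathcal F)$ is the set of members of $\mathcal F$ containing none of Beineke's nine forbidden induced subgraphs $N_1,\dots,N_9$ for line graphs (equivalently, by Beineke's theorem, the members of $\mathcal F$ that are line graphs). -}

module Defs where

open import Data.Nat using (ℕ; _≤_; _<_; _≡ᵇ_)
open import Data.Nat as ℕ using ()
open import Data.Fin using (Fin; toℕ; zero; suc)
open import Data.Fin.Properties using () renaming (_≟_ to _≟Fin_)
open import Data.Bool using (Bool; true; false; _∧_; _∨_; not; if_then_else_)
open import Data.Bool.Properties using (∨-comm)
open import Data.Maybe using (Maybe; just; nothing)
open import Data.Product using (Σ; Σ-syntax; _×_; _,_; proj₁; proj₂)
open import Data.Product.Properties using (≡-dec)
open import Data.Sum using (_⊎_)
open import Data.Unit using (⊤)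
open import Data.List using (List; []; _∷_)
open import Relation.Nullary using (¬_; Dec; yes; no)
open import Relation.Nullary.Decidable using (⌊_⌋)
open import Relation.Binary.Definitions using (DecidableEquality)
open import Relation.Binary.PropositionalEquality using (_≡_; _≢_; refl; cong₂)
open import Function.Definitions using (Injective)
open import Function.Bundles using (_⇔_)

record Graph : Set where
  field
    n      : ℕ
    adj    : Fin n → Fin n → Bool
    sym    : ∀ u v → adj u v ≡ adj v u
    irrefl : ∀ u → adj u u ≡ false
open Graph public

InducedSub : Graph → Graph → Set
InducedSub F G =
  Σ[ f ∈ (Fin (n F) → Fin (n G)) ] Injective _≡_ _≡_ f ×
    (∀ u v → adj F u v ≡ adj G (f u) (f v))

IsoFree : Graph → Set
IsoFree H = ∀ u → Σ[ v ∈ Fin (n H) ] adj H u v ≡ true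

-- H is (isomorphic to) an edge-induced subgraph of G:
-- H has no isolated vertices and embeds injectively into G, edges to edges
-- (the image is then exactly the subgraph of G formed by the image edges
-- together with their endpoints).
EdgeInducedSub : Graph → Graph → Set
EdgeInducedSub H G =
  IsoFree H ×
  (Σ[ f ∈ (Fin (n H) → Fin (n G)) ] Injective _≡_ _≡_ f ×
    (∀ u v → adj H u v ≡ true → adj G (f u) (f v) ≡ true))

-- Boards: the things being coloured (vertices of a graph, or edges of a
-- graph) together with the conflict relation.

record Board : Set₁ where
  field
    V      : Set
    _≟_    : DecidableEquality V
    Active : V → Set          -- the elements that are to be coloured
    Adj    : V → V → Set      -- conflict: must receive distinct colours
open Board public

VertexBoard : Graph → Board
VertexBoard G = record
  { V = Fin (n G) ; _≟_ = _≟Fin_ ; Active = λ _ → ⊤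
  ; Adj = λ u v → adj G u v ≡ true }

IsEdge : (G : Graph) → Fin (n G) × Fin (n G) → Set
IsEdge G (u , v) = toℕ u < toℕ v × adj G u v ≡ true

ShareEnd : {m : ℕ} → Fin m × Fin m → Fin m × Fin m → Set
ShareEnd (u , v) (u' , v') = u ≡ u' ⊎ u ≡ v' ⊎ v ≡ u' ⊎ v ≡ v'

EdgeAdj : {m : ℕ} → Fin m × Fin m → Fin m × Fin m → Set
EdgeAdj e f = e ≢ f × ShareEnd e f

EdgeBoard : Graph → Board
EdgeBoard G = record
  { V = Fin (n G) × Fin (n G) ; _≟_ = ≡-dec _≟Fin_ _≟Fin_
  ; Active = IsEdge G ; Adj = EdgeAdj }

-- Clique number of a board (ω(H) for VertexBoard H, ω(L(H)) for EdgeBoard H)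

Clique : Board → ℕ → Set
Clique B k =
  Σ[ f ∈ (Fin k → V B) ] Injective _≡_ _≡_ f ×
    (∀ i → Active B (f i)) × (∀ i j → i ≢ j → Adj B (f i) (f j))

CliqueNumber : Board → ℕ → Set
CliqueNumber B w = Clique B w × (∀ m → Clique B m → m ≤ w)

data Player : Set where
  alice bob : Player

-- Y ∈ {A, B, -} is represented by Maybe Player (nothing = "-")
module Game (B : Board) (k : ℕ) (Y : Maybe Player) where

  Colouring : Set
  Colouring = V B → Maybe (Fin k)

  empty : Colouring
  empty _ = nothing

  upd : Colouring → V B → Fin k → Colouring
  upd c v a w = if ⌊ _≟_ B w v ⌋ then just a else c w

  Legal : Colouring → V B → Fin k → Set
  Legal c v a = Active B v × c v ≡ nothing × (∀ w → Adj B v w → c w ≢ just a)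

  HasMove : Colouring → Set
  HasMove c = Σ[ v ∈ V B ] Σ[ a ∈ Fin k ] Legal c v a

  Complete : Colouring → Set
  Complete c = ∀ v → Active B v → c v ≢ nothing

  -- AliceWins c p : Alice has a winning strategy from position c with
  -- player p to move.
  data AliceWins : Colouring → Player → Set where
    ended     : ∀ {c p} → ¬ HasMove c → Complete c → AliceWins c p
    aliceMove : ∀ {c} v a → Legal c v a → AliceWins (upd c v a) bob →
                AliceWins c alice
    aliceSkip : ∀ {c} → HasMove c → Y ≡ just alice → AliceWins c bob →
                AliceWins c alice
    bobTurn   : ∀ {c} → HasMove c →
                (∀ v a → Legal c v a → AliceWins (upd c v a) alice) →
                (Y ≡ just bob → AliceWins c alice) →
                AliceWins c bob

AliceWinsGame : Board → Player → Maybe Player → ℕ → Set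
AliceWinsGame B X Y k = Game.AliceWins B k Y (Game.empty B k Y) X

GameChromaticNumber : Board → Player → Maybe Player → ℕ → Set
GameChromaticNumber B X Y k =
  AliceWinsGame B X Y k × (∀ j → j < k → ¬ AliceWinsGame B X Y j)

Perfect : Player → Maybe Player → Graph → Set
Perfect X Y H = ∀ H' → InducedSub H' H →
  ∀ w → CliqueNumber (VertexBoard H') w →
  GameChromaticNumber (VertexBoard H') X Y w

LinePerfect : Player → Maybe Player → Graph → Set
LinePerfect X Y G = ∀ H → EdgeInducedSub H G →
  ∀ w → CliqueNumber (EdgeBoard H) w →
  GameChromaticNumber (EdgeBoard H) X Y w

IsLineGraphOf : Graph → Graph → Set
IsLineGraphOf L H =
  Σ[ φ ∈ (Fin (n L) → Fin (n H) × Fin (n H)) ]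
    (∀ i → IsEdge H (φ i)) × Injective _≡_ _≡_ φ ×
    (∀ e → IsEdge H e → Σ[ i ∈ Fin (n L) ] φ i ≡ e) ×
    (∀ i j → (adj L i j ≡ true) ⇔ EdgeAdj (φ i) (φ j))

Family : Set₁
Family = Graph → Set

LineInv : Family → Family
LineInv 𝓕 H = IsoFree H × Σ[ F ∈ Graph ] 𝓕 F × IsLineGraphOf F H

private
  memPair : ℕ → ℕ → List (ℕ × ℕ) → Bool
  memPair a b [] = false
  memPair a b ((x , y) ∷ es) = ((a ≡ᵇ x) ∧ (b ≡ᵇ y)) ∨ memPair a b es

  ≡ᵇ-sym : ∀ a b → (a ≡ᵇ b) ≡ (b ≡ᵇ a)
  ≡ᵇ-sym ℕ.zero ℕ.zero = refl
  ≡ᵇ-sym ℕ.zero (ℕ.suc b) = refl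
  ≡ᵇ-sym (ℕ.suc a) ℕ.zero = refl
  ≡ᵇ-sym (ℕ.suc a) (ℕ.suc b) = ≡ᵇ-sym a b

  ≡ᵇ-refl : ∀ a → (a ≡ᵇ a) ≡ true
  ≡ᵇ-refl ℕ.zero = refl
  ≡ᵇ-refl (ℕ.suc a) = ≡ᵇ-refl a

private
  not-cong : ∀ {x y} → x ≡ y → not x ≡ not y
  not-cong refl = refl

  falseˡ : ∀ {x} y → x ≡ false → (x ∧ y) ≡ false
  falseˡ y refl = refl

fromEdges : (m : ℕ) → List (ℕ × ℕ) → Graph
fromEdges m es = record
  { n = m
  ; adj = λ u v → not (toℕ u ≡ᵇ toℕ v) ∧
                  (memPair (toℕ u) (toℕ v) es ∨ memPair (toℕ v) (toℕ u) es)
  ; sym = λ u v → cong₂ _∧_ (not-cong (≡ᵇ-sym (toℕ u) (toℕ v)))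
                    (∨-comm (memPair (toℕ u) (toℕ v) es) _)
  ; irrefl = λ u → falseˡ _ (not-cong (≡ᵇ-refl (toℕ u))) }

-- Beineke's nine forbidden induced subgraphs for line graphs
-- (the minimal non-line graphs; edge lists computed/checked by brute force)
beineke : Fin 9 → Graph
beineke zero = fromEdges 4 ((0 , 1) ∷ (0 , 2) ∷ (0 , 3) ∷ [])
beineke (suc zero) = fromEdges 5
  ((0 , 1) ∷ (0 , 2) ∷ (0 , 3) ∷ (0 , 4) ∷ (1 , 2) ∷ (1 , 3) ∷ (1 , 4) ∷
   (2 , 3) ∷ (2 , 4) ∷ [])
beineke (suc (suc zero)) = fromEdges 5
  ((0 , 1) ∷ (0 , 2) ∷ (0 , 3) ∷ (1 , 2) ∷ (1 , 3) ∷ (2 , 4) ∷ (3 , 4) ∷ [])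
beineke (suc (suc (suc zero))) = fromEdges 6
  ((0 , 1) ∷ (0 , 2) ∷ (0 , 3) ∷ (0 , 4) ∷ (0 , 5) ∷ (1 , 2) ∷ (1 , 3) ∷
   (1 , 4) ∷ (1 , 5) ∷ (2 , 3) ∷ (4 , 5) ∷ [])
beineke (suc (suc (suc (suc zero)))) = fromEdges 6
  ((0 , 1) ∷ (0 , 2) ∷ (0 , 3) ∷ (0 , 4) ∷ (0 , 5) ∷ (1 , 2) ∷ (1 , 3) ∷
   (2 , 4) ∷ (3 , 5) ∷ (4 , 5) ∷ [])
beineke (suc (suc (suc (suc (suc zero))))) = fromEdges 6
  ((0 , 1) ∷ (0 , 2) ∷ (0 , 3) ∷ (0 , 4) ∷ (1 , 2) ∷ (1 , 3) ∷ (1 , 4) ∷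
   (2 , 3) ∷ (4 , 5) ∷ [])
beineke (suc (suc (suc (suc (suc (suc zero)))))) = fromEdges 6
  ((0 , 1) ∷ (0 , 2) ∷ (0 , 3) ∷ (0 , 4) ∷ (1 , 2) ∷ (1 , 3) ∷ (1 , 5) ∷
   (2 , 4) ∷ (3 , 5) ∷ [])
beineke (suc (suc (suc (suc (suc (suc (suc zero))))))) = fromEdges 6
  ((0 , 1) ∷ (0 , 2) ∷ (0 , 3) ∷ (1 , 2) ∷ (1 , 3) ∷ (2 , 4) ∷ (3 , 5) ∷ [])
beineke (suc (suc (suc (suc (suc (suc (suc (suc zero)))))))) = fromEdges 6
  ((0 , 1) ∷ (0 , 2) ∷ (0 , 3) ∷ (1 , 2) ∷ (1 , 3) ∷ (2 , 4) ∷ (3 , 5) ∷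
   (4 , 5) ∷ [])

Red : Family → Family
Red 𝓕 F = 𝓕 F × (∀ i → ¬ InducedSub (beineke i) F)

NoEdgeInducedMember : Family → Graph → Set
NoEdgeInducedMember 𝓖 G = ¬ (Σ[ H ∈ Graph ] 𝓖 H × EdgeInducedSub H G)

NoInducedMember : Family → Graph → Set
NoInducedMember 𝓕 H = ¬ (Σ[ F ∈ Graph ] 𝓕 F × InducedSub F H)

-- The line graph operator turns edge-induced subgraphs of G into induced
-- subgraphs of line graphs and back: an induced subgraph F of L(H) is the
-- line graph of the subgraph of H formed by the edges representing F.
-- Since the edge game on H is literally the vertex game on L(H), G is line
-- [X,Y]-perfect iff every line graph of an edge-induced subgraph is
-- [X,Y]-perfect, i.e. iff no such line graph contains a member of 𝓕; such a
-- member is itself a line graph, so one may restrict 𝓕 to line graphs, which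
-- are exactly the members containing none of Beineke's graphs. For the last
-- step only the easy half of Beineke's theorem is needed: no N_i is an
-- induced subgraph of a line graph, checked by an exhaustive search.
module Submission where

open import Defs renaming (sym to adj-sym)
open import Data.Bool using (Bool; true; false; _∧_; _∨_; not; if_then_else_)
open import Data.Bool.Properties using (∨-zeroʳ) renaming (_≟_ to _≟ᵇ_)
open import Data.Empty using (⊥; ⊥-elim)
open import Data.Fin using (Fin; toℕ; zero; suc; remQuot; combine)
open import Data.Fin.Properties using (any?; combine-remQuot; remQuot-combine; <-cmp)
  renaming (_≟_ to _≟ᶠ_)
open import Data.List using (List; []; _∷_; applyDownFrom)
open import Data.Maybe using (Maybe; just; nothing)
open import Data.Maybe.Properties using (just-injective) renaming (≡-dec to ≡-decᵐ)
open import Data.Nat as ℕ using (ℕ; zero; suc; _≤_; _<_; z≤n; s≤s; _⊔_; _+_)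
open import Data.Nat.Properties
  using (<-irrefl; <-asym; <-trans; ≤-refl; ≤-pred; ≤-trans; <-≤-trans; ≤∧≢⇒<; m≤n⇒m<n∨m≡n;
         n<1+n; n≤1+n; m≥n⇒m⊔n≡m; m≤n⇒m⊔n≡n; m≤m⊔n; m≤n⊔m; +-suc; m+n≤o⇒m≤o; anyUpTo?)
open import Data.Product using (Σ-syntax; _×_; _,_; proj₁; proj₂; uncurry)
open import Data.Product.Properties using (≡-dec)
open import Data.Sum using (_⊎_; inj₁; inj₂; reduce)
open import Data.Unit using (⊤; tt)
open import Function using (_∘_)
open import Function.Bundles using (_⇔_; mk⇔; Equivalence)
open import Function.Definitions using (Injective)
open import Relation.Binary using (DecidableEquality; tri<; tri≈; tri>)
open import Relation.Binary.PropositionalEquality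
open import Relation.Nullary using (¬_; Dec; yes; no; does)
open import Relation.Nullary.Decidable using (_×-dec_; _⊎-dec_; ¬?; map′; dec-true; dec-false; does-≡)

record _≅ᴮ_ (B₁ B₂ : Board) : Set where
  field
    to              : ∀ x → Active B₁ x → V B₂
    from            : ∀ y → Active B₂ y → V B₁
    to-active       : ∀ x p → Active B₂ (to x p)
    from-active     : ∀ y q → Active B₁ (from y q)
    to-irrelevant   : ∀ x p p′ → to x p ≡ to x p′
    from-irrelevant : ∀ y q q′ → from y q ≡ from y q′
    from-to         : ∀ x p q → from (to x p) q ≡ x
    to-from         : ∀ y q p → to (from y q) p ≡ y
    to-adj          : ∀ x p x′ p′ → Adj B₁ x x′ → Adj B₂ (to x p) (to x′ p′)
    from-adj        : ∀ y q y′ q′ → Adj B₂ y y′ → Adj B₁ (from y q) (from y′ q′)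

  to-cong : ∀ {x x′} → x ≡ x′ → ∀ p p′ → to x p ≡ to x′ p′
  to-cong refl = to-irrelevant _

  from-cong : ∀ {y y′} → y ≡ y′ → ∀ q q′ → from y q ≡ from y′ q′
  from-cong refl = from-irrelevant _

  to-injective : ∀ {x x′} p p′ → to x p ≡ to x′ p′ → x ≡ x′
  to-injective {x} {x′} p p′ eq = begin
    x                              ≡⟨ sym (from-to x p (to-active x p)) ⟩
    from (to x p) (to-active x p)  ≡⟨ from-cong eq _ (to-active x′ p′) ⟩
    from (to x′ p′) _              ≡⟨ from-to x′ p′ _ ⟩
    x′                             ∎
    where open ≡-Reasoning

≅ᴮ-sym : ∀ {B₁ B₂} → B₁ ≅ᴮ B₂ → B₂ ≅ᴮ B₁
≅ᴮ-sym I = record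
  { to = from ; from = to ; to-active = from-active ; from-active = to-active
  ; to-irrelevant = from-irrelevant ; from-irrelevant = to-irrelevant
  ; from-to = to-from ; to-from = from-to ; to-adj = from-adj ; from-adj = to-adj }
  where open _≅ᴮ_ I

module GameTransport {B₁ B₂ : Board} (I : B₁ ≅ᴮ B₂) (k : ℕ) (Y : Maybe Player) where
  open _≅ᴮ_ I
  private
    module G₁ = Game B₁ k Y
    module G₂ = Game B₂ k Y

  -- Only active elements are ever coloured, so a coloured neighbour can be
  -- carried across the isomorphism when checking legality.
  record Matches (c₁ : G₁.Colouring) (c₂ : G₂.Colouring) : Set where
    field
      agree   : ∀ x p → c₂ (to x p) ≡ c₁ x
      active₁ : ∀ x a → c₁ x ≡ just a → Active B₁ x
      active₂ : ∀ y a → c₂ y ≡ just a → Active B₂ y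

    agree-from : ∀ y q → c₁ (from y q) ≡ c₂ y
    agree-from y q = trans (sym (agree (from y q) (from-active y q))) (cong c₂ (to-from y q _))
  open Matches

  matches-empty : Matches G₁.empty G₂.empty
  matches-empty = record { agree = λ _ _ → refl ; active₁ = λ _ _ () ; active₂ = λ _ _ () }

  legal-to : ∀ {c₁ c₂ x a} → Matches c₁ c₂ → (L : G₁.Legal c₁ x a) →
             G₂.Legal c₂ (to x (proj₁ L)) a
  legal-to {c₂ = c₂} {x} {a} M (p , free , fresh) = to-active x p , trans (agree M x p) free , fresh′
    where
    fresh′ : ∀ w → Adj B₂ (to x p) w → c₂ w ≢ just a
    fresh′ w adj-w cw = fresh (from w q)
      (subst (λ z → Adj B₁ z (from w q)) (from-to x p _) (from-adj (to x p) (to-active x p) w q adj-w))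
      (trans (agree-from M w q) cw)
      where q = active₂ M w a cw

  legal-from : ∀ {c₁ c₂ y a} → Matches c₁ c₂ → (L : G₂.Legal c₂ y a) →
               G₁.Legal c₁ (from y (proj₁ L)) a
  legal-from {c₁ = c₁} {y = y} {a} M (q , free , fresh) =
    from-active y q , trans (agree-from M y q) free , fresh′
    where
    fresh′ : ∀ w → Adj B₁ (from y q) w → c₁ w ≢ just a
    fresh′ w adj-w cw = fresh (to w p)
      (subst (λ z → Adj B₂ z (to w p)) (to-from y q _) (to-adj (from y q) (from-active y q) w p adj-w))
      (trans (agree M w p) cw)
      where p = active₁ M w a cw

  hasMove-to : ∀ {c₁ c₂} → Matches c₁ c₂ → G₁.HasMove c₁ → G₂.HasMove c₂
  hasMove-to M (x , a , L) = to x (proj₁ L) , a , legal-to M L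

  hasMove-from : ∀ {c₁ c₂} → Matches c₁ c₂ → G₂.HasMove c₂ → G₁.HasMove c₁
  hasMove-from M (y , a , L) = from y (proj₁ L) , a , legal-from M L

  matches-upd : ∀ {c₁ c₂ x a} → Matches c₁ c₂ → (p : Active B₁ x) →
                Matches (G₁.upd c₁ x a) (G₂.upd c₂ (to x p) a)
  matches-upd {c₁} {c₂} {x} {a} M p = record { agree = agree′ ; active₁ = active₁′ ; active₂ = active₂′ }
    where
    agree′ : ∀ x′ p′ → G₂.upd c₂ (to x p) a (to x′ p′) ≡ G₁.upd c₁ x a x′
    agree′ x′ p′ with _≟_ B₂ (to x′ p′) (to x p) | _≟_ B₁ x′ x
    ... | yes _  | yes _  = refl
    ... | yes eq | no ne  = ⊥-elim (ne (to-injective p′ p eq))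
    ... | no ne  | yes eq = ⊥-elim (ne (to-cong eq p′ p))
    ... | no _   | no _   = agree M x′ p′
    active₁′ : ∀ x′ b → G₁.upd c₁ x a x′ ≡ just b → Active B₁ x′
    active₁′ x′ b eq with _≟_ B₁ x′ x
    ... | yes refl = p
    ... | no _     = active₁ M x′ b eq
    active₂′ : ∀ y b → G₂.upd c₂ (to x p) a y ≡ just b → Active B₂ y
    active₂′ y b eq with _≟_ B₂ y (to x p)
    ... | yes refl = to-active x p
    ... | no _     = active₂ M y b eq

  matches-upd-from : ∀ {c₁ c₂ y a} → Matches c₁ c₂ → (q : Active B₂ y) →
                     Matches (G₁.upd c₁ (from y q) a) (G₂.upd c₂ y a)
  matches-upd-from {c₁} {c₂} {y} {a} M q =
    subst (λ z → Matches (G₁.upd c₁ (from y q) a) (G₂.upd c₂ z a))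
          (to-from y q _) (matches-upd M (from-active y q))

  aliceWins-transport : ∀ {c₁ c₂ pl} → Matches c₁ c₂ → G₁.AliceWins c₁ pl → G₂.AliceWins c₂ pl
  aliceWins-transport M (G₁.ended stuck complete) =
    G₂.ended (stuck ∘ hasMove-from M)
             (λ y q → complete (from y q) (from-active y q) ∘ trans (agree-from M y q))
  aliceWins-transport M (G₁.aliceMove _ a L W) =
    G₂.aliceMove _ a (legal-to M L) (aliceWins-transport (matches-upd M (proj₁ L)) W)
  aliceWins-transport M (G₁.aliceSkip hm eq W) =
    G₂.aliceSkip (hasMove-to M hm) eq (aliceWins-transport M W)
  aliceWins-transport M (G₁.bobTurn hm bobMove bobSkip) =
    G₂.bobTurn (hasMove-to M hm)
      (λ y a L → aliceWins-transport (matches-upd-from M (proj₁ L)) (bobMove _ a (legal-from M L)))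
      (aliceWins-transport M ∘ bobSkip)

aliceWinsGame-≅ : ∀ {B₁ B₂} → B₁ ≅ᴮ B₂ → ∀ {X Y k} →
                  AliceWinsGame B₁ X Y k → AliceWinsGame B₂ X Y k
aliceWinsGame-≅ I {Y = Y} {k} = aliceWins-transport matches-empty
  where open GameTransport I k Y

gameChromaticNumber-≅ : ∀ {B₁ B₂} → B₁ ≅ᴮ B₂ → ∀ {X Y w} →
                        GameChromaticNumber B₁ X Y w → GameChromaticNumber B₂ X Y w
gameChromaticNumber-≅ I (wins , fewer-lose) =
  aliceWinsGame-≅ I wins , λ j j<w → fewer-lose j j<w ∘ aliceWinsGame-≅ (≅ᴮ-sym I)

clique-≅ : ∀ {B₁ B₂} → B₁ ≅ᴮ B₂ → ∀ {m} → Clique B₁ m → Clique B₂ m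
clique-≅ I (f , f-inj , f-active , f-adj) =
  (λ i → to (f i) (f-active i)) ,
  (λ {i} {j} eq → f-inj (to-injective (f-active i) (f-active j) eq)) ,
  (λ i → to-active (f i) (f-active i)) ,
  (λ i j i≢j → to-adj (f i) (f-active i) (f j) (f-active j) (f-adj i j i≢j))
  where open _≅ᴮ_ I

cliqueNumber-≅ : ∀ {B₁ B₂} → B₁ ≅ᴮ B₂ → ∀ {w} → CliqueNumber B₁ w → CliqueNumber B₂ w
cliqueNumber-≅ I (clique , maximal) = clique-≅ I clique , λ m → maximal m ∘ clique-≅ (≅ᴮ-sym I)

dec-true⁻¹ : ∀ {P : Set} (P? : Dec P) → does P? ≡ true → P
dec-true⁻¹ (yes p) _ = p

record Enumeration {N : ℕ} (P : Fin N → Set) : Set where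
  field
    size        : ℕ
    at          : Fin size → Fin N
    at-mono     : ∀ i j → toℕ i < toℕ j → toℕ (at i) < toℕ (at j)
    at-sound    : ∀ i → P (at i)
    at-complete : ∀ x → P x → Σ[ i ∈ Fin size ] at i ≡ x

  at-injective : Injective _≡_ _≡_ at
  at-injective {i} {j} eq with <-cmp i j
  ... | tri< i<j _ _ = ⊥-elim (<-irrefl (cong toℕ eq) (at-mono i j i<j))
  ... | tri≈ _ i≡j _ = i≡j
  ... | tri> _ _ j<i = ⊥-elim (<-irrefl (cong toℕ (sym eq)) (at-mono j i j<i))

  at-cancel-< : ∀ i j → toℕ (at i) < toℕ (at j) → toℕ i < toℕ j
  at-cancel-< i j lt with <-cmp i j
  ... | tri< i<j _ _ = i<j
  ... | tri≈ _ refl _ = ⊥-elim (<-irrefl refl lt)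
  ... | tri> _ _ j<i = ⊥-elim (<-asym lt (at-mono j i j<i))

enumerate : ∀ {N} (P : Fin N → Set) → (∀ x → Dec (P x)) → Enumeration P
enumerate {zero} P P? =
  record { size = 0 ; at = λ () ; at-mono = λ () ; at-sound = λ () ; at-complete = λ () }
enumerate {suc N} P P? with P? zero | enumerate (P ∘ suc) (P? ∘ suc)
... | yes p₀ | E = record
  { size = suc size ; at = at′ ; at-mono = at-mono′ ; at-sound = at-sound′ ; at-complete = at-complete′ }
  where
  open Enumeration E
  at′ : Fin (suc size) → Fin (suc N)
  at′ zero    = zero
  at′ (suc i) = suc (at i)
  at-mono′ : ∀ i j → toℕ i < toℕ j → toℕ (at′ i) < toℕ (at′ j)
  at-mono′ zero    (suc j) _         = s≤s z≤n
  at-mono′ (suc i) (suc j) (s≤s lt) = s≤s (at-mono i j lt)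
  at-sound′ : ∀ i → P (at′ i)
  at-sound′ zero    = p₀
  at-sound′ (suc i) = at-sound i
  at-complete′ : ∀ x → P x → Σ[ i ∈ Fin (suc size) ] at′ i ≡ x
  at-complete′ zero    _  = zero , refl
  at-complete′ (suc x) px with at-complete x px
  ... | i , refl = suc i , refl
... | no ¬p₀ | E = record
  { size = size ; at = suc ∘ at ; at-mono = λ i j lt → s≤s (at-mono i j lt)
  ; at-sound = at-sound ; at-complete = at-complete′ }
  where
  open Enumeration E
  at-complete′ : ∀ x → P x → Σ[ i ∈ Fin size ] suc (at i) ≡ x
  at-complete′ zero    px = ⊥-elim (¬p₀ px)
  at-complete′ (suc x) px with at-complete x px
  ... | i , refl = i , refl

shareEnd? : ∀ {m} (e f : Fin m × Fin m) → Dec (ShareEnd e f)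
shareEnd? (u , v) (u′ , v′) = u ≟ᶠ u′ ⊎-dec u ≟ᶠ v′ ⊎-dec v ≟ᶠ u′ ⊎-dec v ≟ᶠ v′

edgeAdj? : ∀ {m} (e f : Fin m × Fin m) → Dec (EdgeAdj e f)
edgeAdj? e f = ¬? (≡-dec _≟ᶠ_ _≟ᶠ_ e f) ×-dec shareEnd? e f

isEdge? : ∀ G e → Dec (IsEdge G e)
isEdge? G (u , v) = toℕ u ℕ.<? toℕ v ×-dec adj G u v ≟ᵇ true

ShareEnd-sym : ∀ {m} {e f : Fin m × Fin m} → ShareEnd e f → ShareEnd f e
ShareEnd-sym (inj₁ p)               = inj₁ (sym p)
ShareEnd-sym (inj₂ (inj₁ p))        = inj₂ (inj₂ (inj₁ (sym p)))
ShareEnd-sym (inj₂ (inj₂ (inj₁ p))) = inj₂ (inj₁ (sym p))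
ShareEnd-sym (inj₂ (inj₂ (inj₂ p))) = inj₂ (inj₂ (inj₂ (sym p)))

EdgeAdj-sym : ∀ {m} {e f : Fin m × Fin m} → EdgeAdj e f → EdgeAdj f e
EdgeAdj-sym (e≢f , share) = e≢f ∘ sym , ShareEnd-sym share

EdgeAdj-map⇔ : ∀ {m N} {h : Fin m → Fin N} → Injective _≡_ _≡_ h → ∀ a b c d →
               EdgeAdj (h a , h b) (h c , h d) ⇔ EdgeAdj (a , b) (c , d)
EdgeAdj-map⇔ {h = h} h-inj a b c d = mk⇔ reflect preserve
  where
  reflect : EdgeAdj (h a , h b) (h c , h d) → EdgeAdj (a , b) (c , d)
  reflect (ne , share) = ne ∘ cong (λ e → h (proj₁ e) , h (proj₂ e)) , shared share
    where
    shared : ShareEnd (h a , h b) (h c , h d) → ShareEnd (a , b) (c , d)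
    shared (inj₁ p)               = inj₁ (h-inj p)
    shared (inj₂ (inj₁ p))        = inj₂ (inj₁ (h-inj p))
    shared (inj₂ (inj₂ (inj₁ p))) = inj₂ (inj₂ (inj₁ (h-inj p)))
    shared (inj₂ (inj₂ (inj₂ p))) = inj₂ (inj₂ (inj₂ (h-inj p)))
  preserve : EdgeAdj (a , b) (c , d) → EdgeAdj (h a , h b) (h c , h d)
  preserve (ne , share) = (λ eq → ne (cong₂ _,_ (h-inj (cong proj₁ eq)) (h-inj (cong proj₂ eq)))) , shared share
    where
    shared : ShareEnd (a , b) (c , d) → ShareEnd (h a , h b) (h c , h d)
    shared (inj₁ p)               = inj₁ (cong h p)
    shared (inj₂ (inj₁ p))        = inj₂ (inj₁ (cong h p))
    shared (inj₂ (inj₂ (inj₁ p))) = inj₂ (inj₂ (inj₁ (cong h p)))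
    shared (inj₂ (inj₂ (inj₂ p))) = inj₂ (inj₂ (inj₂ (cong h p)))

-- F is isomorphic to an induced subgraph of the line graph L(H).
record EdgeRepresentation (F H : Graph) : Set where
  field
    edgeOf           : Fin (n F) → Fin (n H) × Fin (n H)
    edgeOf-isEdge    : ∀ x → IsEdge H (edgeOf x)
    edgeOf-injective : Injective _≡_ _≡_ edgeOf
    adj⇔EdgeAdj      : ∀ x y → (adj F x y ≡ true) ⇔ EdgeAdj (edgeOf x) (edgeOf y)

  edgeOf-ordered : ∀ x → toℕ (proj₁ (edgeOf x)) < toℕ (proj₂ (edgeOf x))
  edgeOf-ordered = proj₁ ∘ edgeOf-isEdge

edgeRepresentation : ∀ {F H} → IsLineGraphOf F H → EdgeRepresentation F H
edgeRepresentation (φ , φ-isEdge , φ-inj , _ , φ-adj) = record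
  { edgeOf = φ ; edgeOf-isEdge = φ-isEdge ; edgeOf-injective = φ-inj ; adj⇔EdgeAdj = φ-adj }

edgeRepresentation-inducedSub : ∀ {F L H} → InducedSub F L → EdgeRepresentation L H → EdgeRepresentation F H
edgeRepresentation-inducedSub (g , g-inj , g-adj) R = record
  { edgeOf = edgeOf ∘ g
  ; edgeOf-isEdge = edgeOf-isEdge ∘ g
  ; edgeOf-injective = g-inj ∘ edgeOf-injective
  ; adj⇔EdgeAdj = λ x y → mk⇔
      (Equivalence.to (adj⇔EdgeAdj (g x) (g y)) ∘ trans (sym (g-adj x y)))
      (trans (g-adj x y) ∘ Equivalence.from (adj⇔EdgeAdj (g x) (g y))) }
  where open EdgeRepresentation R

-- The vertices of the line graph enumerate the pairs (u , v) of Fin (n H)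
-- with u < v and uv ∈ E(H), encoded as elements of Fin (n H * n H).
module LineGraph (H : Graph) where
  private
    N = n H
    open Enumeration (enumerate (IsEdge H ∘ remQuot N) (isEdge? H ∘ remQuot N))

  edgeAt : Fin size → Fin N × Fin N
  edgeAt = remQuot N ∘ at

  lineGraph : Graph
  lineGraph = record
    { n = size
    ; adj = λ i j → does (edgeAdj? (edgeAt i) (edgeAt j))
    ; sym = λ i j → does-≡ (map′ EdgeAdj-sym EdgeAdj-sym (edgeAdj? (edgeAt i) (edgeAt j)))
                           (edgeAdj? (edgeAt j) (edgeAt i))
    ; irrefl = λ i → dec-false (edgeAdj? (edgeAt i) (edgeAt i)) (λ adj-ii → proj₁ adj-ii refl) }

  edgeAt-injective : Injective _≡_ _≡_ edgeAt
  edgeAt-injective {i} {j} eq = at-injective (begin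
    at i                           ≡⟨ combine-remQuot {N} N (at i) ⟨
    uncurry combine (edgeAt i)     ≡⟨ cong (uncurry combine) eq ⟩
    uncurry combine (edgeAt j)     ≡⟨ combine-remQuot {N} N (at j) ⟩
    at j                           ∎)
    where open ≡-Reasoning

  edgeAt-surjective : ∀ e → IsEdge H e → Σ[ i ∈ Fin size ] edgeAt i ≡ e
  edgeAt-surjective (u , v) uv-edge with at-complete (combine u v) (subst (IsEdge H) (sym (remQuot-combine u v)) uv-edge)
  ... | i , at-i = i , trans (cong (remQuot N) at-i) (remQuot-combine u v)

  lineGraph-isLineGraph : IsLineGraphOf lineGraph H
  lineGraph-isLineGraph =
    edgeAt , at-sound , edgeAt-injective , edgeAt-surjective ,
    λ i j → mk⇔ (dec-true⁻¹ (edgeAdj? (edgeAt i) (edgeAt j))) (dec-true (edgeAdj? (edgeAt i) (edgeAt j)))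

open LineGraph using (lineGraph; lineGraph-isLineGraph)

vertexBoard≅edgeBoard : ∀ {F H} → IsLineGraphOf F H → VertexBoard F ≅ᴮ EdgeBoard H
vertexBoard≅edgeBoard (φ , φ-isEdge , φ-inj , φ-onto , φ-adj) = record
  { to = λ x _ → φ x
  ; from = λ e e-edge → proj₁ (φ-onto e e-edge)
  ; to-active = λ x _ → φ-isEdge x
  ; from-active = λ _ _ → tt
  ; to-irrelevant = λ _ _ _ → refl
  ; from-irrelevant = λ e q q′ → φ-inj (trans (proj₂ (φ-onto e q)) (sym (proj₂ (φ-onto e q′))))
  ; from-to = λ x _ q → φ-inj (proj₂ (φ-onto (φ x) q))
  ; to-from = λ e q _ → proj₂ (φ-onto e q)
  ; to-adj = λ x _ x′ _ → Equivalence.to (φ-adj x x′)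
  ; from-adj = λ e q e′ q′ adj-ee′ → Equivalence.from (φ-adj _ _)
      (subst₂ EdgeAdj (sym (proj₂ (φ-onto e q))) (sym (proj₂ (φ-onto e′ q′))) adj-ee′) }

inducedSub-refl : ∀ F → InducedSub F F
inducedSub-refl F = (λ x → x) , (λ eq → eq) , λ _ _ → refl

edgeInducedSub-trans : ∀ {H₁ H₂ H₃} → EdgeInducedSub H₁ H₂ → EdgeInducedSub H₂ H₃ →
                       EdgeInducedSub H₁ H₃
edgeInducedSub-trans (isoFree , f , f-inj , f-edge) (_ , g , g-inj , g-edge) =
  isoFree , g ∘ f , f-inj ∘ g-inj , λ u v → g-edge _ _ ∘ f-edge u v

-- The edge-induced subgraph of H spanned by the edges representing F; its
-- vertices enumerate, in increasing order, the endpoints of these edges.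
module EdgeSpan {F H : Graph} (R : EdgeRepresentation F H) where
  open EdgeRepresentation R

  Spanned : Fin (n H) → Fin (n H) → Set
  Spanned u v = Σ[ i ∈ Fin (n F) ] (edgeOf i ≡ (u , v) ⊎ edgeOf i ≡ (v , u))

  spanned? : ∀ u v → Dec (Spanned u v)
  spanned? u v = any? λ i → edgeOf i ≟ᵉ (u , v) ⊎-dec edgeOf i ≟ᵉ (v , u)
    where _≟ᵉ_ = ≡-dec _≟ᶠ_ _≟ᶠ_

  Spanned-sym : ∀ {u v} → Spanned u v → Spanned v u
  Spanned-sym (i , inj₁ p) = i , inj₂ p
  Spanned-sym (i , inj₂ p) = i , inj₁ p

  Spanned-irrefl : ∀ u → ¬ Spanned u u
  Spanned-irrefl u (i , eq) =
    <-irrefl refl (subst (λ e → toℕ (proj₁ e) < toℕ (proj₂ e)) (reduce eq) (edgeOf-ordered i))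

  Endpoint : Fin (n H) → Set
  Endpoint x = Σ[ i ∈ Fin (n F) ] (proj₁ (edgeOf i) ≡ x ⊎ proj₂ (edgeOf i) ≡ x)

  endpoint? : ∀ x → Dec (Endpoint x)
  endpoint? x = any? λ i → proj₁ (edgeOf i) ≟ᶠ x ⊎-dec proj₂ (edgeOf i) ≟ᶠ x

  open Enumeration (enumerate Endpoint endpoint?)

  span : Graph
  span = record
    { n = size
    ; adj = λ a b → does (spanned? (at a) (at b))
    ; sym = λ a b → does-≡ (map′ Spanned-sym Spanned-sym (spanned? (at a) (at b))) (spanned? (at b) (at a))
    ; irrefl = λ a → dec-false (spanned? (at a) (at a)) (Spanned-irrefl (at a)) }

  start : ∀ i → Σ[ a ∈ Fin size ] at a ≡ proj₁ (edgeOf i)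
  start i = at-complete _ (i , inj₁ refl)

  end : ∀ i → Σ[ a ∈ Fin size ] at a ≡ proj₂ (edgeOf i)
  end i = at-complete _ (i , inj₂ refl)

  spanEdge : Fin (n F) → Fin size × Fin size
  spanEdge i = proj₁ (start i) , proj₁ (end i)

  edgeOf≡at : ∀ i → edgeOf i ≡ (at (proj₁ (spanEdge i)) , at (proj₂ (spanEdge i)))
  edgeOf≡at i = cong₂ _,_ (sym (proj₂ (start i))) (sym (proj₂ (end i)))

  spanEdge-isEdge : ∀ i → IsEdge span (spanEdge i)
  spanEdge-isEdge i =
    at-cancel-< _ _ (subst (λ e → toℕ (proj₁ e) < toℕ (proj₂ e)) (edgeOf≡at i) (edgeOf-ordered i)) ,
    dec-true (spanned? _ _) (i , inj₁ (edgeOf≡at i))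

  spanEdge-injective : Injective _≡_ _≡_ spanEdge
  spanEdge-injective {i} {j} eq = edgeOf-injective
    (trans (edgeOf≡at i) (trans (cong (λ e → at (proj₁ e) , at (proj₂ e)) eq) (sym (edgeOf≡at j))))

  spanEdge-surjective : ∀ e → IsEdge span e → Σ[ i ∈ Fin (n F) ] spanEdge i ≡ e
  spanEdge-surjective (a , b) (a<b , ab-edge) with dec-true⁻¹ (spanned? (at a) (at b)) ab-edge
  ... | i , inj₁ p = i , cong₂ _,_ (at-injective (trans (proj₂ (start i)) (cong proj₁ p)))
                                  (at-injective (trans (proj₂ (end i)) (cong proj₂ p)))
  ... | i , inj₂ p = ⊥-elim (<-asym (at-mono a b a<b)
                       (subst (λ e → toℕ (proj₁ e) < toℕ (proj₂ e)) p (edgeOf-ordered i)))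

  spanEdge-adj : ∀ i j → (adj F i j ≡ true) ⇔ EdgeAdj (spanEdge i) (spanEdge j)
  spanEdge-adj i j = mk⇔
    (Equivalence.to (EdgeAdj-map⇔ at-injective _ _ _ _)
      ∘ subst₂ EdgeAdj (edgeOf≡at i) (edgeOf≡at j) ∘ Equivalence.to (adj⇔EdgeAdj i j))
    (Equivalence.from (adj⇔EdgeAdj i j)
      ∘ subst₂ EdgeAdj (sym (edgeOf≡at i)) (sym (edgeOf≡at j))
      ∘ Equivalence.from (EdgeAdj-map⇔ at-injective _ _ _ _))

  span-isLineGraph : IsLineGraphOf F span
  span-isLineGraph = spanEdge , spanEdge-isEdge , spanEdge-injective , spanEdge-surjective , spanEdge-adj

  span-isoFree : IsoFree span
  span-isoFree a with at-sound a
  ... | i , inj₁ p = proj₁ (end i) , dec-true (spanned? _ _) (i , inj₁ (cong₂ _,_ p (sym (proj₂ (end i)))))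
  ... | i , inj₂ p = proj₁ (start i) , dec-true (spanned? _ _) (i , inj₂ (cong₂ _,_ (sym (proj₂ (start i))) p))

  at-preservesEdges : ∀ a b → adj span a b ≡ true → adj H (at a) (at b) ≡ true
  at-preservesEdges a b ab-edge with dec-true⁻¹ (spanned? (at a) (at b)) ab-edge
  ... | i , inj₁ p = subst (λ e → adj H (proj₁ e) (proj₂ e) ≡ true) p (proj₂ (edgeOf-isEdge i))
  ... | i , inj₂ p = trans (adj-sym H (at a) (at b))
                       (subst (λ e → adj H (proj₁ e) (proj₂ e) ≡ true) p (proj₂ (edgeOf-isEdge i)))

  span-edgeInducedSub : EdgeInducedSub span H
  span-edgeInducedSub = span-isoFree , at , at-injective , at-preservesEdges

edgeRepresentation⇒edgeInducedSub : ∀ {F H} → EdgeRepresentation F H →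
  Σ[ H′ ∈ Graph ] IsLineGraphOf F H′ × EdgeInducedSub H′ H
edgeRepresentation⇒edgeInducedSub R = span , span-isLineGraph , span-edgeInducedSub
  where open EdgeSpan R

inducedSub-lineGraph : ∀ {F L H} → IsLineGraphOf L H → InducedSub F L →
  Σ[ H′ ∈ Graph ] IsLineGraphOf F H′ × EdgeInducedSub H′ H
inducedSub-lineGraph {F} {L} {H} L-lg F⊆L =
  edgeRepresentation⇒edgeInducedSub (edgeRepresentation-inducedSub {F} F⊆L (edgeRepresentation {L} {H} L-lg))

ShareEndℕ : ℕ × ℕ → ℕ × ℕ → Set
ShareEndℕ (a , b) (c , d) = a ≡ c ⊎ a ≡ d ⊎ b ≡ c ⊎ b ≡ d

shareEndℕ? : ∀ l l′ → Dec (ShareEndℕ l l′)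
shareEndℕ? (a , b) (c , d) = a ℕ.≟ c ⊎-dec a ℕ.≟ d ⊎-dec b ℕ.≟ c ⊎-dec b ℕ.≟ d

SameEdge : {A : Set} → A × A → A × A → Set
SameEdge (a , b) (c , d) = (a ≡ c × b ≡ d) ⊎ (a ≡ d × b ≡ c)

sameEdge? : {A : Set} → DecidableEquality A → ∀ (e f : A × A) → Dec (SameEdge e f)
sameEdge? _≟ᴬ_ (a , b) (c , d) = (a ≟ᴬ c ×-dec b ≟ᴬ d) ⊎-dec (a ≟ᴬ d ×-dec b ≟ᴬ c)

Row : Set
Row = List Bool

rowMatches : Row → ℕ × ℕ → List (ℕ × ℕ) → Bool
rowMatches [] _ [] = true
rowMatches (bit ∷ row) l (l′ ∷ ls) =
  (if bit then does (shareEndℕ? l l′) else not (does (shareEndℕ? l l′))) ∧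
  (not (does (sameEdge? ℕ._≟_ l l′)) ∧ rowMatches row l ls)
rowMatches _ _ _ = false

anyBelow : ℕ → (ℕ → Bool) → Bool
anyBelow zero    f = false
anyBelow (suc k) f = f k ∨ anyBelow k f

-- Vertex number |ls| is given an edge whose endpoints are labels among the t
-- already used, or the fresh label t: labels are interchangeable, so this
-- loses no representation.
realisable : List Row → ℕ → List (ℕ × ℕ) → Bool
realisable [] t ls = true
realisable (row ∷ rows) t ls =
  anyBelow (suc t) λ a → anyBelow (suc (t ⊔ suc a)) λ b →
    not (does (a ℕ.≟ b)) ∧ (rowMatches row (a , b) ls ∧ realisable rows ((t ⊔ suc a) ⊔ suc b) ((a , b) ∷ ls))

toFin? : (m : ℕ) → ℕ → Maybe (Fin m)
toFin? zero    _       = nothing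
toFin? (suc m) zero    = just zero
toFin? (suc m) (suc i) = Data.Maybe.map suc (toFin? m i)

adjMaybe : (G : Graph) → Maybe (Fin (n G)) → Maybe (Fin (n G)) → Bool
adjMaybe G (just x) (just y) = adj G x y
adjMaybe G _        _        = false

adjℕ : (G : Graph) → ℕ → ℕ → Bool
adjℕ G i j = adjMaybe G (toFin? (n G) i) (toFin? (n G) j)

-- Row j records the adjacency of vertex j to the vertices j - 1, …, 0.
lowerRows : (ℕ → ℕ → Bool) → ℕ → ℕ → List Row
lowerRows M j zero    = []
lowerRows M j (suc r) = applyDownFrom (M j) j ∷ lowerRows M (suc j) r

lineSearch : Graph → Bool
lineSearch G = realisable (lowerRows (adjℕ G) 0 (n G)) 0 []

∧-intro : ∀ {a b} → a ≡ true → b ≡ true → a ∧ b ≡ true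
∧-intro refl refl = refl

anyBelow-intro : ∀ k (f : ℕ → Bool) x → x < k → f x ≡ true → anyBelow k f ≡ true
anyBelow-intro (suc k) f x x<1+k fx with m≤n⇒m<n∨m≡n (≤-pred x<1+k)
... | inj₂ refl = cong (_∨ anyBelow k f) fx
... | inj₁ x<k  = trans (cong (f k ∨_) (anyBelow-intro k f x x<k fx)) (∨-zeroʳ (f k))

toFin?-just : ∀ m i → i < m → Σ[ x ∈ Fin m ] toFin? m i ≡ just x × toℕ x ≡ i
toFin?-just (suc m) zero    _         = zero , refl , refl
toFin?-just (suc m) (suc i) (s≤s i<m) with toFin?-just m i i<m
... | x , x-i , refl = suc x , cong (Data.Maybe.map suc) x-i , refl

module Completeness (N : ℕ) where
  Edge : Set
  Edge = Fin N × Fin N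

  RowRealised : Row → Edge → List Edge → Set
  RowRealised []          e []        = ⊤
  RowRealised (bit ∷ row) e (e′ ∷ es) =
    (bit ≡ true ⇔ ShareEnd e e′) × ¬ SameEdge e e′ × RowRealised row e es
  RowRealised _           _ _         = ⊥

  Realised : List Edge → List Row → List Edge → Set
  Realised prev []           []       = ⊤
  Realised prev (row ∷ rows) (e ∷ es) =
    proj₁ e ≢ proj₂ e × RowRealised row e prev × Realised (e ∷ prev) rows es
  Realised _    _            _        = ⊥

  Labelling : Set
  Labelling = ℕ → Maybe (Fin N)

  InjectiveBelow : ℕ → Labelling → Set
  InjectiveBelow t ρ = ∀ x y → x < t → y < t → ρ x ≡ ρ y → x ≡ y

  Tracks : ℕ → Labelling → List (ℕ × ℕ) → List Edge → Set
  Tracks t ρ []             []             = ⊤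
  Tracks t ρ ((a , b) ∷ ls) ((u , v) ∷ es) = a < t × b < t × ρ a ≡ just u × ρ b ≡ just v × Tracks t ρ ls es
  Tracks _ _ _              _              = ⊥

  Tracks-mono : ∀ {t t′ ρ ρ′} ls es → t ≤ t′ → (∀ x → x < t → ρ′ x ≡ ρ x) →
                Tracks t ρ ls es → Tracks t′ ρ′ ls es
  Tracks-mono []             []       _    _      _ = tt
  Tracks-mono ((a , b) ∷ ls) (_ ∷ es) t≤t′ agrees (a<t , b<t , ρa , ρb , tracks) =
    <-≤-trans a<t t≤t′ , <-≤-trans b<t t≤t′ , trans (agrees a a<t) ρa , trans (agrees b b<t) ρb ,
    Tracks-mono ls es t≤t′ agrees tracks

  module _ {t : ℕ} {ρ : Labelling} (ρ-inj : InjectiveBelow t ρ) where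
    label-cong : ∀ {x y u v} → ρ x ≡ just u → ρ y ≡ just v → x ≡ y → u ≡ v
    label-cong ρx ρy refl = just-injective (trans (sym ρx) ρy)

    label-injective : ∀ {x y u v} → x < t → y < t → ρ x ≡ just u → ρ y ≡ just v → u ≡ v → x ≡ y
    label-injective {x} {y} x<t y<t ρx ρy refl = ρ-inj x y x<t y<t (trans ρx (sym ρy))

    rowMatches-complete : ∀ row ls es {a b u v} → a < t → b < t → ρ a ≡ just u → ρ b ≡ just v →
                          Tracks t ρ ls es → RowRealised row (u , v) es → rowMatches row (a , b) ls ≡ true
    rowMatches-complete []          []             []                _   _   _  _  _ _ = refl
    rowMatches-complete (bit ∷ row) ((c , d) ∷ ls) ((u′ , v′) ∷ es) {a} {b} {u} {v} a<t b<t ρa ρb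
                        (c<t , d<t , ρc , ρd , tracks) (bit⇔share , ¬same , realised) =
      ∧-intro (bit-matches bit bit⇔share)
        (∧-intro (cong not (dec-false (sameEdge? ℕ._≟_ _ _) (¬same ∘ same)))
          (rowMatches-complete row ls es a<t b<t ρa ρb tracks realised))
      where
      share : ShareEndℕ (a , b) (c , d) → ShareEnd (u , v) (u′ , v′)
      share (inj₁ eq)               = inj₁ (label-cong ρa ρc eq)
      share (inj₂ (inj₁ eq))        = inj₂ (inj₁ (label-cong ρa ρd eq))
      share (inj₂ (inj₂ (inj₁ eq))) = inj₂ (inj₂ (inj₁ (label-cong ρb ρc eq)))
      share (inj₂ (inj₂ (inj₂ eq))) = inj₂ (inj₂ (inj₂ (label-cong ρb ρd eq)))
      shareℕ : ShareEnd (u , v) (u′ , v′) → ShareEndℕ (a , b) (c , d)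
      shareℕ (inj₁ eq)               = inj₁ (label-injective a<t c<t ρa ρc eq)
      shareℕ (inj₂ (inj₁ eq))        = inj₂ (inj₁ (label-injective a<t d<t ρa ρd eq))
      shareℕ (inj₂ (inj₂ (inj₁ eq))) = inj₂ (inj₂ (inj₁ (label-injective b<t c<t ρb ρc eq)))
      shareℕ (inj₂ (inj₂ (inj₂ eq))) = inj₂ (inj₂ (inj₂ (label-injective b<t d<t ρb ρd eq)))
      same : SameEdge (a , b) (c , d) → SameEdge (u , v) (u′ , v′)
      same (inj₁ (a≡c , b≡d)) = inj₁ (label-cong ρa ρc a≡c , label-cong ρb ρd b≡d)
      same (inj₂ (a≡d , b≡c)) = inj₂ (label-cong ρa ρd a≡d , label-cong ρb ρc b≡c)
      bit-matches : ∀ bit → (bit ≡ true ⇔ ShareEnd (u , v) (u′ , v′)) →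
        (if bit then does (shareEndℕ? (a , b) (c , d)) else not (does (shareEndℕ? (a , b) (c , d)))) ≡ true
      bit-matches true  bit⇔share = dec-true (shareEndℕ? _ _) (shareℕ (Equivalence.to bit⇔share refl))
      bit-matches false bit⇔share =
        cong not (dec-false (shareEndℕ? _ _) (λ s → false≢true (Equivalence.from bit⇔share (share s))))
        where
        false≢true : false ≢ true
        false≢true ()
    rowMatches-complete []      []      (_ ∷ _) _ _ _ _ () _
    rowMatches-complete []      (_ ∷ _) []      _ _ _ _ () _
    rowMatches-complete []      (_ ∷ _) (_ ∷ _) _ _ _ _ _  ()
    rowMatches-complete (_ ∷ _) []      []      _ _ _ _ _  ()
    rowMatches-complete (_ ∷ _) []      (_ ∷ _) _ _ _ _ () _
    rowMatches-complete (_ ∷ _) (_ ∷ _) []      _ _ _ _ () _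

  extend : Labelling → ℕ → Fin N → Labelling
  extend ρ t u y with y ℕ.≟ t
  ... | yes _ = just u
  ... | no  _ = ρ y

  extend-at : ∀ {ρ t u} → extend ρ t u t ≡ just u
  extend-at {t = t} with t ℕ.≟ t
  ... | yes _ = refl
  ... | no t≢t = ⊥-elim (t≢t refl)

  extend-below : ∀ {ρ t u} x → x < t → extend ρ t u x ≡ ρ x
  extend-below {t = t} x x<t with x ℕ.≟ t
  ... | yes refl = ⊥-elim (<-irrefl refl x<t)
  ... | no  _    = refl

  extend-injective : ∀ {t ρ u} → InjectiveBelow t ρ → ¬ (Σ[ x ∈ ℕ ] x < t × ρ x ≡ just u) →
                     InjectiveBelow (suc t) (extend ρ t u)
  extend-injective {t} ρ-inj unused x y x<1+t y<1+t eq with x ℕ.≟ t | y ℕ.≟ t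
  ... | yes x≡t | yes y≡t = trans x≡t (sym y≡t)
  ... | yes _   | no y≢t  = ⊥-elim (unused (y , ≤∧≢⇒< (≤-pred y<1+t) y≢t , sym eq))
  ... | no x≢t  | yes _   = ⊥-elim (unused (x , ≤∧≢⇒< (≤-pred x<1+t) x≢t , eq))
  ... | no x≢t  | no y≢t  = ρ-inj x y (≤∧≢⇒< (≤-pred x<1+t) x≢t) (≤∧≢⇒< (≤-pred y<1+t) y≢t) eq

  record LabelExtension (t : ℕ) (ρ : Labelling) (u : Fin N) : Set where
    field
      label      : ℕ
      label<1+t  : label < suc t
      labelling  : Labelling
      injective  : InjectiveBelow (t ⊔ suc label) labelling
      labels-u   : labelling label ≡ just u
      agrees     : ∀ x → x < t → labelling x ≡ ρ x

  labelFor : ∀ t ρ → InjectiveBelow t ρ → ∀ u → LabelExtension t ρ u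
  labelFor t ρ ρ-inj u with anyUpTo? (λ x → ≡-decᵐ _≟ᶠ_ (ρ x) (just u)) t
  ... | yes (x , x<t , ρx) = record
    { label = x ; label<1+t = <-trans x<t (n<1+n t) ; labelling = ρ
    ; injective = subst (λ s → InjectiveBelow s ρ) (sym (m≥n⇒m⊔n≡m x<t)) ρ-inj
    ; labels-u = ρx ; agrees = λ _ _ → refl }
  ... | no unused = record
    { label = t ; label<1+t = n<1+n t ; labelling = extend ρ t u
    ; injective = subst (λ s → InjectiveBelow s (extend ρ t u)) (sym (m≤n⇒m⊔n≡n (n≤1+n t)))
                        (extend-injective ρ-inj unused)
    ; labels-u = extend-at {ρ} {t} {u} ; agrees = extend-below }

  realisable-complete : ∀ rows t ρ ls prev es → InjectiveBelow t ρ → Tracks t ρ ls prev →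
                        Realised prev rows es → realisable rows t ls ≡ true
  realisable-complete []           t ρ ls prev []             _     _      _ = refl
  realisable-complete (row ∷ rows) t ρ ls prev ((u , v) ∷ es) ρ-inj tracks (u≢v , row-ok , rest) =
    anyBelow-intro (suc t) _ a a<1+t (anyBelow-intro (suc t₁) _ b b<1+t₁ found)
    where
    open LabelExtension (labelFor t ρ ρ-inj u) using ()
      renaming (label to a; label<1+t to a<1+t; labelling to ρ₁; injective to ρ₁-inj;
                labels-u to ρ₁a; agrees to ρ₁-agrees)
    t₁ = t ⊔ suc a
    open LabelExtension (labelFor t₁ ρ₁ ρ₁-inj v) using ()
      renaming (label to b; label<1+t to b<1+t₁; labelling to ρ₂; injective to ρ₂-inj;
                labels-u to ρ₂b; agrees to ρ₂-agrees)
    t₂ = t₁ ⊔ suc b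
    a<t₁ : a < t₁
    a<t₁ = m≤n⊔m t (suc a)
    a<t₂ : a < t₂
    a<t₂ = <-≤-trans a<t₁ (m≤m⊔n t₁ (suc b))
    b<t₂ : b < t₂
    b<t₂ = m≤n⊔m t₁ (suc b)
    ρ₂a : ρ₂ a ≡ just u
    ρ₂a = trans (ρ₂-agrees a a<t₁) ρ₁a
    tracks₂ : Tracks t₂ ρ₂ ls prev
    tracks₂ = Tracks-mono ls prev (m≤m⊔n t₁ (suc b)) ρ₂-agrees
                (Tracks-mono ls prev (m≤m⊔n t (suc a)) ρ₁-agrees tracks)
    found : not (does (a ℕ.≟ b)) ∧ (rowMatches row (a , b) ls ∧ realisable rows t₂ ((a , b) ∷ ls)) ≡ true
    found = ∧-intro (cong not (dec-false (a ℕ.≟ b) (u≢v ∘ label-cong ρ₂-inj ρ₂a ρ₂b)))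
              (∧-intro (rowMatches-complete ρ₂-inj row ls prev a<t₂ b<t₂ ρ₂a ρ₂b tracks₂ row-ok)
                (realisable-complete rows t₂ ρ₂ ((a , b) ∷ ls) ((u , v) ∷ prev) es ρ₂-inj
                  (a<t₂ , b<t₂ , ρ₂a , ρ₂b , tracks₂) rest))
  realisable-complete []      _ _ _ _ (_ ∷ _) _ _ ()
  realisable-complete (_ ∷ _) _ _ _ _ []      _ _ ()

-- The vertex v₀ only supplies a junk edge for indices beyond n G.
module LineSearchComplete {G H : Graph} (R : EdgeRepresentation G H) (v₀ : Fin (n G)) where
  open EdgeRepresentation R
  open Completeness (n H)
  private
    k = n G

  edgeOrJunk : Maybe (Fin k) → Edge
  edgeOrJunk (just x) = edgeOf x
  edgeOrJunk nothing  = edgeOf v₀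

  edgeℕ : ℕ → Edge
  edgeℕ = edgeOrJunk ∘ toFin? k

  distinct-pair : ∀ x y → x ≢ y →
    (adj G x y ≡ true ⇔ ShareEnd (edgeOf x) (edgeOf y)) × ¬ SameEdge (edgeOf x) (edgeOf y)
  distinct-pair x y x≢y =
    mk⇔ (proj₂ ∘ Equivalence.to (adj⇔EdgeAdj x y))
        (λ share → Equivalence.from (adj⇔EdgeAdj x y) (x≢y ∘ edgeOf-injective , share)) ,
    not-same
    where
    not-same : ¬ SameEdge (edgeOf x) (edgeOf y)
    not-same (inj₁ (p , q)) = x≢y (edgeOf-injective (cong₂ _,_ p q))
    not-same (inj₂ (p , q)) = <-irrefl refl
      (<-trans (subst₂ (λ a b → toℕ a < toℕ b) p q (edgeOf-ordered x)) (edgeOf-ordered y))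

  pair-realised : ∀ i j → j < i → i < k →
    (adjℕ G i j ≡ true ⇔ ShareEnd (edgeℕ i) (edgeℕ j)) × ¬ SameEdge (edgeℕ i) (edgeℕ j)
  pair-realised i j j<i i<k with toFin?-just k i i<k | toFin?-just k j (<-trans j<i i<k)
  ... | x , x-i , refl | y , y-j , refl rewrite x-i | y-j =
    distinct-pair x y (λ x≡y → <-irrefl (cong toℕ (sym x≡y)) j<i)

  endpoints-distinct : ∀ i → i < k → proj₁ (edgeℕ i) ≢ proj₂ (edgeℕ i)
  endpoints-distinct i i<k with toFin?-just k i i<k
  ... | x , x-i , _ rewrite x-i = λ eq → <-irrefl (cong toℕ eq) (edgeOf-ordered x)

  row-realised : ∀ i j → j ≤ i → i < k →
    RowRealised (applyDownFrom (adjℕ G i) j) (edgeℕ i) (applyDownFrom edgeℕ j)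
  row-realised i zero    _       _   = tt
  row-realised i (suc j) 1+j≤i i<k =
    proj₁ (pair-realised i j 1+j≤i i<k) , proj₂ (pair-realised i j 1+j≤i i<k) ,
    row-realised i j (≤-trans (n≤1+n j) 1+j≤i) i<k

  edgesFrom : ℕ → ℕ → List Edge
  edgesFrom j zero    = []
  edgesFrom j (suc r) = edgeℕ j ∷ edgesFrom (suc j) r

  rows-realised : ∀ j r → j + r ≤ k →
    Realised (applyDownFrom edgeℕ j) (lowerRows (adjℕ G) j r) (edgesFrom j r)
  rows-realised j zero    _       = tt
  rows-realised j (suc r) j+1+r≤k =
    endpoints-distinct j j<k , row-realised j j ≤-refl j<k , rows-realised (suc j) r 1+j+r≤k
    where
    1+j+r≤k : suc j + r ≤ k
    1+j+r≤k = subst (_≤ k) (+-suc j r) j+1+r≤k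
    j<k : j < k
    j<k = m+n≤o⇒m≤o (suc j) 1+j+r≤k

  lineSearch-complete : lineSearch G ≡ true
  lineSearch-complete =
    realisable-complete (lowerRows (adjℕ G) 0 k) 0 (λ _ → nothing) [] [] (edgesFrom 0 k)
      (λ _ _ ()) tt (rows-realised 0 k ≤-refl)

lineSearch-refutes : ∀ {G H} → Fin (n G) → lineSearch G ≡ false → ¬ EdgeRepresentation G H
lineSearch-refutes v₀ fails R with trans (sym (LineSearchComplete.lineSearch-complete R v₀)) fails
... | ()

beineke-notEdgeRepresentable : ∀ i {H} → ¬ EdgeRepresentation (beineke i) H
beineke-notEdgeRepresentable zero                                         = lineSearch-refutes zero refl
beineke-notEdgeRepresentable (suc zero)                                   = lineSearch-refutes zero refl
beineke-notEdgeRepresentable (suc (suc zero))                             = lineSearch-refutes zero refl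
beineke-notEdgeRepresentable (suc (suc (suc zero)))                       = lineSearch-refutes zero refl
beineke-notEdgeRepresentable (suc (suc (suc (suc zero))))                 = lineSearch-refutes zero refl
beineke-notEdgeRepresentable (suc (suc (suc (suc (suc zero)))))           = lineSearch-refutes zero refl
beineke-notEdgeRepresentable (suc (suc (suc (suc (suc (suc zero))))))     = lineSearch-refutes zero refl
beineke-notEdgeRepresentable (suc (suc (suc (suc (suc (suc (suc zero))))))) = lineSearch-refutes zero refl
beineke-notEdgeRepresentable (suc (suc (suc (suc (suc (suc (suc (suc zero)))))))) = lineSearch-refutes zero refl

lineGraph-beinekeFree : ∀ {F H} → IsLineGraphOf F H → ∀ i → ¬ InducedSub (beineke i) F
lineGraph-beinekeFree {F} {H} F-lg i N⊆F =
  beineke-notEdgeRepresentable i (edgeRepresentation-inducedSub N⊆F (edgeRepresentation {F} {H} F-lg))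

module _ {X : Player} {Y : Maybe Player} where

  linePerfect-edgeInducedSub : ∀ {H G} → EdgeInducedSub H G → LinePerfect X Y G → LinePerfect X Y H
  linePerfect-edgeInducedSub {H} {G} H⊆G G-linePerfect H′ H′⊆H =
    G-linePerfect H′ (edgeInducedSub-trans {H′} {H} {G} H′⊆H H⊆G)

  linePerfect⇒perfect : ∀ {F H} → IsLineGraphOf F H → LinePerfect X Y H → Perfect X Y F
  linePerfect⇒perfect {F} {H} F-lg H-linePerfect F′ F′⊆F w ω
    with inducedSub-lineGraph {F′} {F} {H} F-lg F′⊆F
  ... | H′ , F′-lg , H′⊆H =
    gameChromaticNumber-≅ (≅ᴮ-sym I) (H-linePerfect H′ H′⊆H w (cliqueNumber-≅ I ω))
    where I = vertexBoard≅edgeBoard {F′} {H′} F′-lg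

  perfect⇒gameChromaticNumber : ∀ {F H} → IsLineGraphOf F H → Perfect X Y F →
    ∀ w → CliqueNumber (EdgeBoard H) w → GameChromaticNumber (EdgeBoard H) X Y w
  perfect⇒gameChromaticNumber {F} {H} F-lg F-perfect w ω =
    gameChromaticNumber-≅ I (F-perfect F (inducedSub-refl F) w (cliqueNumber-≅ (≅ᴮ-sym I) ω))
    where I = vertexBoard≅edgeBoard {F} {H} F-lg

  module _ {𝓕 : Family} {G : Graph} where

    linePerfect⇒noLineInv : (∀ F → Perfect X Y F → NoInducedMember 𝓕 F) →
      LinePerfect X Y G → NoEdgeInducedMember (LineInv 𝓕) G
    linePerfect⇒noLineInv perfect⇒free G-linePerfect (H , (_ , F , F∈𝓕 , F-lg) , H⊆G) =
      perfect⇒free F (linePerfect⇒perfect {F} {H} F-lg (linePerfect-edgeInducedSub {H} {G} H⊆G G-linePerfect))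
        (F , F∈𝓕 , inducedSub-refl F)

    noLineInv⇒linePerfect : (∀ F → NoInducedMember 𝓕 F → Perfect X Y F) →
      NoEdgeInducedMember (LineInv 𝓕) G → LinePerfect X Y G
    noLineInv⇒linePerfect free⇒perfect none H H⊆G =
      perfect⇒gameChromaticNumber {lineGraph H} {H} L-lg (free⇒perfect (lineGraph H) noMember)
      where
      L-lg : IsLineGraphOf (lineGraph H) H
      L-lg = lineGraph-isLineGraph H
      noMember : NoInducedMember 𝓕 (lineGraph H)
      noMember (F , F∈𝓕 , F⊆L) with inducedSub-lineGraph {F} {lineGraph H} {H} L-lg F⊆L
      ... | H′ , F-lg , H′⊆H =
        none (H′ , (proj₁ H′⊆H , F , F∈𝓕 , F-lg) , edgeInducedSub-trans {H′} {H} {G} H′⊆H H⊆G)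

noLineInv⇔noLineInvRed : ∀ {𝓕 G} →
  NoEdgeInducedMember (LineInv 𝓕) G ⇔ NoEdgeInducedMember (LineInv (Red 𝓕)) G
noLineInv⇔noLineInvRed {𝓕} {G} = mk⇔ forget-red add-red
  where
  forget-red : NoEdgeInducedMember (LineInv 𝓕) G → NoEdgeInducedMember (LineInv (Red 𝓕)) G
  forget-red none (H , (H-isoFree , F , (F∈𝓕 , _) , F-lg) , H⊆G) =
    none (H , (H-isoFree , F , F∈𝓕 , F-lg) , H⊆G)
  add-red : NoEdgeInducedMember (LineInv (Red 𝓕)) G → NoEdgeInducedMember (LineInv 𝓕) G
  add-red none (H , (H-isoFree , F , F∈𝓕 , F-lg) , H⊆G) =
    none (H , (H-isoFree , F , (F∈𝓕 , lineGraph-beinekeFree {F} {H} F-lg) , F-lg) , H⊆G)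

theorem28 : (X : Player) (Y : Maybe Player) (𝓕 : Family) →
    (∀ H → Perfect X Y H ⇔ NoInducedMember 𝓕 H) →
    (G : Graph) →
      (LinePerfect X Y G ⇔ NoEdgeInducedMember (LineInv 𝓕) G) ×
      (NoEdgeInducedMember (LineInv 𝓕) G ⇔ NoEdgeInducedMember (LineInv (Red 𝓕)) G)
theorem28 X Y 𝓕 perfect⇔free G =
  mk⇔ (linePerfect⇒noLineInv {G = G} (λ F → Equivalence.to (perfect⇔free F)))
      (noLineInv⇒linePerfect {G = G} (λ F → Equivalence.from (perfect⇔free F))) ,
  noLineInv⇔noLineInvRed {𝓕} {G}
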